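{- Let $k\ge2$ and let $n_1,n_2>1$ be integers. Suppose $[c_0,\dots,c_{k-1}]$ is an algebraic $k$-gon modulo $n_1n_2$ with monodromy group $N\rtimes C_k$, where $N\subseteq(\mathbb{Z}/n_1n_2\mathbb{Z})^k$. Then there exists an algebraic $k$-gon $[a_0,\dots,a_{k-1}]$ modulo $n_1$ with monodromy group $(n_2N)\rtimes C_k$, where $n_2N=\{n_2v:v\in N\}$. If $\gcd(n_1,n_2)=1$, then $(n_2N)\rtimes C_k\cong(N/n_1N)\rtimes C_k$.
   Context: An algebraic $k$-gon modulo $n$ ($k\ge2$) is a $k$-tuple of nonnegative integers $[a_0,\dots,a_{k-1}]$ with $\sum a_i\equiv0\pmod n$ and $\gcd(a_0,\dots,a_{k-1},n)=1$. Its monodromy group is $N\rtimes C_k$, where $N\subseteq(\mathbb{Z}/n\mathbb{Z})^k$ is the additive subgroup generated by the columns of the circulant matrix with $(i,j)$ entry $a_{(i-j)\bmod k}$, and $C_k$ acts on $N$ by cyclic permutation of coordinates. Saying the monodromy group is $A\rtimes C_k$ for an abelian group $A$ means the subgroup $N$ is isomorphic to $A$. -}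

module Defs where

open import Data.Nat as ℕ using (ℕ; zero; suc)
open import Data.Nat.GCD using (gcd)
open import Data.Integer as ℤ using (ℤ; +_; _-_; _+_; _*_)
open import Data.Integer.Divisibility using (_∣_)
open import Data.Fin using (Fin; zero; suc; fromℕ; inject₁; toℕ)
open import Data.Product using (Σ; _×_; _,_; proj₁; proj₂)
open import Relation.Binary.PropositionalEquality using (_≡_)

-- Integer vectors of length k (representatives of elements of (ℤ/nℤ)^k).
Vecℤ : ℕ → Set
Vecℤ k = Fin k → ℤ

_≡_[mod_] : ℤ → ℤ → ℕ → Set
a ≡ b [mod n ] = (+ n) ∣ (a - b)

_≋_[mod_] : ∀ {k} → Vecℤ k → Vecℤ k → ℕ → Set
v ≋ w [mod n ] = ∀ i → v i ≡ w i [mod n ]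

sumℕ : ∀ {k} → (Fin k → ℕ) → ℕ
sumℕ {zero}  a = 0
sumℕ {suc k} a = a zero ℕ.+ sumℕ (λ i → a (suc i))

sumℤ : ∀ {k} → (Fin k → ℤ) → ℤ
sumℤ {zero}  a = + 0
sumℤ {suc k} a = a zero + sumℤ (λ i → a (suc i))

gcdAll : ∀ {k} → (Fin k → ℕ) → ℕ → ℕ
gcdAll {zero}  a n = n
gcdAll {suc k} a n = gcd (a zero) (gcdAll (λ i → a (suc i)) n)

record IsAlgebraicGon (k n : ℕ) (a : Fin k → ℕ) : Set where
  field
    sum≡0   : (+ sumℕ a) ≡ (+ 0) [mod n ]
    coprime : gcdAll a n ≡ 1

-- Cyclic permutation of coordinates: (σ v)_i = v_{i-1 mod k}.
σ : ∀ {k} → Vecℤ k → Vecℤ k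
σ {zero}  v i = v i
σ {suc m} v zero    = v (fromℕ m)
σ {suc m} v (suc i) = v (inject₁ i)

σ^ : ∀ {k} → ℕ → Vecℤ k → Vecℤ k
σ^ zero    v = v
σ^ (suc j) v = σ (σ^ j v)

_⊕_ : ∀ {k} → Vecℤ k → Vecℤ k → Vecℤ k
(v ⊕ w) i = v i + w i

_⊖_ : ∀ {k} → Vecℤ k → Vecℤ k → Vecℤ k
(v ⊖ w) i = v i - w i

toℤ : ∀ {k} → (Fin k → ℕ) → Vecℤ k
toℤ a i = + a i

-- Column j of the circulant matrix with (i,j) entry a_{(i-j) mod k}.
column : ∀ {k} → (Fin k → ℕ) → Fin k → Vecℤ k
column a j = σ^ (toℕ j) (toℤ a)

-- Membership in N ⊆ (ℤ/nℤ)^k: the additive subgroup generated by the columns.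
InMonodromy : ∀ {k} → ℕ → (Fin k → ℕ) → Vecℤ k → Set
InMonodromy {k} n a v =
  Σ (Fin k → ℤ) λ x → v ≋ (λ i → sumℤ (λ j → x j * column a j i)) [mod n ]

-- A subquotient of ℤ^k: elements are vectors satisfying Mem,
-- two elements are equal iff their difference satisfies Null.
record SQ (k : ℕ) : Set₁ where
  field
    Mem  : Vecℤ k → Set
    Null : Vecℤ k → Set
open SQ public

Elt : ∀ {k} → SQ k → Set
Elt {k} S = Σ (Vecℤ k) (Mem S)

monodromySQ : ∀ {k} → ℕ → (Fin k → ℕ) → SQ k
monodromySQ n a = record { Mem = InMonodromy n a ; Null = λ v → v ≋ (λ _ → + 0) [mod n ] }

scaledSQ : ∀ {k} → (M c : ℕ) → (Vecℤ k → Set) → SQ k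
scaledSQ {k} M c P = record
  { Mem  = λ v → Σ (Vecℤ k) λ w → P w × (v ≋ (λ i → + c * w i) [mod M ])
  ; Null = λ v → v ≋ (λ _ → + 0) [mod M ] }

quotientSQ : ∀ {k} → (M c : ℕ) → (Vecℤ k → Set) → SQ k
quotientSQ {k} M c P = record
  { Mem  = P
  ; Null = λ v → Σ (Vecℤ k) λ w → P w × (v ≋ (λ i → + c * w i) [mod M ]) }

record AbIso {k} (S T : SQ k) : Set where
  field
    f    : Elt S → Elt T
    resp : ∀ x y → Null S (proj₁ x ⊖ proj₁ y) → Null T (proj₁ (f x) ⊖ proj₁ (f y))
    hom  : ∀ x y z → (∀ i → proj₁ z i ≡ proj₁ x i + proj₁ y i) →
           Null T (proj₁ (f z) ⊖ (proj₁ (f x) ⊕ proj₁ (f y)))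
    inj  : ∀ x y → Null T (proj₁ (f x) ⊖ proj₁ (f y)) → Null S (proj₁ x ⊖ proj₁ y)
    surj : (y : Elt T) → Σ (Elt S) λ x → Null T (proj₁ (f x) ⊖ proj₁ y)

-- Elements of S ⋊ C_k: pairs (v , j) standing for (v , σ^j), j taken modulo k,
-- with product (v , j)(w , l) = (v + σ^j w , j + l).
SDElt : ∀ {k} → SQ k → Set
SDElt S = Elt S × ℕ

SDEq : ∀ {k} → SQ k → Vecℤ k × ℕ → Vecℤ k × ℕ → Set
SDEq {k} S (v , j) (w , l) = Null S (v ⊖ w) × ((+ j) ≡ (+ l) [mod k ])

raw : ∀ {k} {S : SQ k} → SDElt S → Vecℤ k × ℕ
raw x = (proj₁ (proj₁ x) , proj₂ x)

sdMul : ∀ {k} → Vecℤ k × ℕ → Vecℤ k × ℕ → Vecℤ k × ℕ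
sdMul (v , j) (w , l) = (v ⊕ σ^ j w , j ℕ.+ l)

record SDIso {k} (S T : SQ k) : Set where
  field
    F    : SDElt S → SDElt T
    resp : ∀ x y → SDEq S (raw {S = S} x) (raw {S = S} y) →
           SDEq T (raw {S = T} (F x)) (raw {S = T} (F y))
    hom  : ∀ x y z → SDEq S (raw {S = S} z) (sdMul (raw {S = S} x) (raw {S = S} y)) →
           SDEq T (raw {S = T} (F z)) (sdMul (raw {S = T} (F x)) (raw {S = T} (F y)))
    inj  : ∀ x y → SDEq T (raw {S = T} (F x)) (raw {S = T} (F y)) →
           SDEq S (raw {S = S} x) (raw {S = S} y)
    surj : (y : SDElt T) → Σ (SDElt S) λ x → SDEq T (raw {S = T} (F x)) (raw {S = T} y)

-- Reducing c modulo n₁ keeps it an algebraic k-gon, and multiplication by n₂ is an injective map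
-- from (ℤ/n₁)^k to (ℤ/n₁n₂)^k sending the circulant columns of c mod n₁ to n₂ times those mod n₁n₂,
-- so it maps the monodromy subgroup of c mod n₁ onto n₂N.  When s n₁ + t n₂ = 1, sending n₂w to
-- the class of w is a well-defined injection n₂N → N/n₁N: if n₂w ≡ 0 then
-- w = n₁(sw) + t(n₂w) ≡ n₁(sw) with sw ∈ N, and conversely w ∈ n₁N gives n₂w ≡ 0.  The cyclic
-- shift permutes the circulant columns, so N is shift-invariant and this isomorphism extends by
-- the identity on C_k to the semidirect products.
module Submission where

open import Defs
open import Data.Nat as ℕ using (ℕ; zero; suc; NonZero)
import Data.Nat.Properties as ℕP
import Data.Nat.Divisibility as ℕ
open import Data.Nat.DivMod using (_%_; [m+n]%n≡m%n; [m+kn]%n≡m%n; m<n⇒m%n≡m)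
open import Data.Nat.GCD using (gcd; gcd[m,n]∣m; gcd[m,n]∣n; gcd-greatest; gcd-GCD; module Bézout)
import Data.Nat.Tactic.RingSolver as ℕSolver
open import Data.Integer using (ℤ; +_; _+_; _*_; -_; _-_; ∣_∣)
import Data.Integer.Properties as ℤP
open import Data.Integer.Divisibility.Signed as Signed using (∣ᵤ⇒∣; ∣⇒∣ᵤ)
open import Data.Integer.Tactic.RingSolver using (solve; solve-∀)
open import Data.Fin using (Fin; zero; suc; fromℕ; inject₁; toℕ)
open import Data.Fin.Properties using (toℕ-injective; toℕ<n; toℕ-fromℕ; toℕ-inject₁)
open import Data.List using (_∷_; [])
open import Data.Product using (Σ; ∃; ∃₂; _×_; _,_; proj₁)
open import Level using (0ℓ)
open import Relation.Binary.Bundles using (Setoid)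
open import Relation.Binary.PropositionalEquality
  using (_≡_; _≗_; refl; sym; trans; cong; cong₂; subst; module ≡-Reasoning)
import Relation.Binary.Reasoning.Setoid as SetoidReasoning

-- `_≡_[mod_]` unfolds to divisibility of |x - y|, so its integer arguments cannot be inferred by
-- unification and the lemmas below take them explicitly.

private
  signed : ∀ {n} x y → x ≡ y [mod n ] → + n Signed.∣ (x - y)
  signed x y = ∣ᵤ⇒∣

  mod-by : ∀ {n d} x y → + n Signed.∣ d → d ≡ x - y → x ≡ y [mod n ]
  mod-by x y n∣d refl = ∣⇒∣ᵤ n∣d

mod-reflexive : ∀ {n x y} → x ≡ y → x ≡ y [mod n ]
mod-reflexive {n} {x} refl rewrite ℤP.+-inverseʳ x = n ℕ.∣0

mod-refl : ∀ {n} x → x ≡ x [mod n ]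
mod-refl x = mod-reflexive {x = x} refl

mod-sym : ∀ {n} x y → x ≡ y [mod n ] → y ≡ x [mod n ]
mod-sym {n} x y = subst (n ℕ.∣_) (ℤP.∣i-j∣≡∣j-i∣ x y)

mod-trans : ∀ {n} x y z → x ≡ y [mod n ] → y ≡ z [mod n ] → x ≡ z [mod n ]
mod-trans x y z p q =
  mod-by x z (Signed.∣m∣n⇒∣m+n (signed x y p) (signed y z q)) (solve (x ∷ y ∷ z ∷ []))

modSetoid : ℕ → Setoid 0ℓ 0ℓ
modSetoid n = record
  { Carrier       = ℤ
  ; _≈_           = _≡_[mod n ]
  ; isEquivalence = record
    { refl  = λ {x} → mod-refl x
    ; sym   = λ {x} {y} → mod-sym x y
    ; trans = λ {x} {y} {z} → mod-trans x y z
    }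
  }

mod-+-cong : ∀ {n} x y u v → x ≡ y [mod n ] → u ≡ v [mod n ] → (x + u) ≡ (y + v) [mod n ]
mod-+-cong x y u v p q =
  mod-by (x + u) (y + v) (Signed.∣m∣n⇒∣m+n (signed x y p) (signed u v q)) (solve (x ∷ y ∷ u ∷ v ∷ []))

mod-*-congˡ : ∀ {n} c x y → x ≡ y [mod n ] → (c * x) ≡ (c * y) [mod n ]
mod-*-congˡ c x y p =
  mod-by (c * x) (c * y) (Signed.∣n⇒∣m*n c (signed x y p)) (solve (c ∷ x ∷ y ∷ []))

mod-multiple : ∀ {n} q → (q * + n) ≡ + 0 [mod n ]
mod-multiple q = mod-by (q * _) (+ 0) (Signed.divides q refl) (sym (ℤP.+-identityʳ _))

-≡0⇒≡ : ∀ {n} x y → (x - y) ≡ + 0 [mod n ] → x ≡ y [mod n ]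
-≡0⇒≡ {n} x y = subst (n ℕ.∣_) (cong ∣_∣ (ℤP.+-identityʳ (x - y)))

≡⇒-≡0 : ∀ {n} x y → x ≡ y [mod n ] → (x - y) ≡ + 0 [mod n ]
≡⇒-≡0 {n} x y = subst (n ℕ.∣_) (cong ∣_∣ (sym (ℤP.+-identityʳ (x - y))))

private
  *-distribˡ-- : ∀ c x y → c * (x - y) ≡ c * x - c * y
  *-distribˡ-- = solve-∀

  ∣n*x-n*y∣ : ∀ n x y → ∣ + n * x - + n * y ∣ ≡ ∣ x - y ∣ ℕ.* n
  ∣n*x-n*y∣ n x y = begin
    ∣ + n * x - + n * y ∣   ≡⟨ cong ∣_∣ (*-distribˡ-- (+ n) x y) ⟨
    ∣ + n * (x - y) ∣       ≡⟨ ℤP.abs-* (+ n) (x - y) ⟩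
    n ℕ.* ∣ x - y ∣         ≡⟨ ℕP.*-comm n _ ⟩
    ∣ x - y ∣ ℕ.* n         ∎
    where open ≡-Reasoning

mod-*-scale : ∀ {m} n x y → x ≡ y [mod m ] → (+ n * x) ≡ (+ n * y) [mod m ℕ.* n ]
mod-*-scale {m} n x y p = subst (m ℕ.* n ℕ.∣_) (sym (∣n*x-n*y∣ n x y)) (ℕ.*-monoˡ-∣ n p)

mod-*-cancel : ∀ {m} n .{{_ : NonZero n}} x y → (+ n * x) ≡ (+ n * y) [mod m ℕ.* n ] → x ≡ y [mod m ]
mod-*-cancel {m} n x y p = ℕ.*-cancelʳ-∣ n (subst (m ℕ.* n ℕ.∣_) (∣n*x-n*y∣ n x y) p)

cpred : ∀ {k} → Fin k → Fin k
cpred {suc m} zero    = fromℕ m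
cpred         (suc i) = inject₁ i

cpred^ : ∀ {k} → ℕ → Fin k → Fin k
cpred^ zero    i = i
cpred^ (suc j) i = cpred^ j (cpred i)

σ-apply : ∀ {k} (v : Vecℤ k) i → σ v i ≡ v (cpred i)
σ-apply v zero    = refl
σ-apply v (suc i) = refl

σ^-apply : ∀ {k} j (v : Vecℤ k) i → σ^ j v i ≡ v (cpred^ j i)
σ^-apply zero    v i = refl
σ^-apply (suc j) v i = trans (σ-apply (σ^ j v) i) (σ^-apply j v (cpred i))

toℕ-cpred : ∀ {m} (i : Fin (suc m)) → ∃ λ e → toℕ (cpred i) ℕ.+ 1 ≡ toℕ i ℕ.+ e ℕ.* suc m
toℕ-cpred {m} zero    = 1 , trans (cong (ℕ._+ 1) (toℕ-fromℕ m)) (ℕSolver.solve (m ∷ []))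
toℕ-cpred     (suc i) = 0 , trans (cong (ℕ._+ 1) (toℕ-inject₁ i))
                               (trans (ℕP.+-comm _ 1) (sym (ℕP.+-identityʳ _)))

toℕ-cpred^ : ∀ {m} j (i : Fin (suc m)) → ∃ λ e → toℕ (cpred^ j i) ℕ.+ j ≡ toℕ i ℕ.+ e ℕ.* suc m
toℕ-cpred^ zero    i = 0 , refl
toℕ-cpred^ {m} (suc j) i with toℕ-cpred^ j (cpred i) | toℕ-cpred i
... | e , p | e′ , q = e′ ℕ.+ e , (begin
  toℕ (cpred^ j (cpred i)) ℕ.+ suc j      ≡⟨ ℕP.+-suc _ j ⟩
  suc (toℕ (cpred^ j (cpred i)) ℕ.+ j)    ≡⟨ cong suc p ⟩
  suc (toℕ (cpred i) ℕ.+ e ℕ.* suc m)     ≡⟨ cong (ℕ._+ e ℕ.* suc m) (trans (ℕP.+-comm 1 _) q) ⟩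
  toℕ i ℕ.+ e′ ℕ.* suc m ℕ.+ e ℕ.* suc m ≡⟨ regroup (toℕ i) e′ e (suc m) ⟩
  toℕ i ℕ.+ (e′ ℕ.+ e) ℕ.* suc m         ∎)
  where
  open ≡-Reasoning
  regroup : ∀ t a b k → t ℕ.+ a ℕ.* k ℕ.+ b ℕ.* k ≡ t ℕ.+ (a ℕ.+ b) ℕ.* k
  regroup = ℕSolver.solve-∀

cpred^-period : ∀ {k} (i : Fin k) → cpred^ k i ≡ i
cpred^-period {suc m} i with toℕ-cpred^ (suc m) i
... | e , p = toℕ-injective (begin
  t                                  ≡⟨ m<n⇒m%n≡m (toℕ<n (cpred^ (suc m) i)) ⟨
  t % suc m                          ≡⟨ [m+n]%n≡m%n t (suc m) ⟨
  (t ℕ.+ suc m) % suc m              ≡⟨ cong (_% suc m) p ⟩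
  (toℕ i ℕ.+ e ℕ.* suc m) % suc m    ≡⟨ [m+kn]%n≡m%n (toℕ i) e (suc m) ⟩
  toℕ i % suc m                      ≡⟨ m<n⇒m%n≡m (toℕ<n i) ⟩
  toℕ i                              ∎)
  where
  open ≡-Reasoning
  t : ℕ
  t = toℕ (cpred^ (suc m) i)

σ^-period : ∀ {k} (v : Vecℤ k) i → σ^ k v i ≡ v i
σ^-period {k} v i = trans (σ^-apply k v i) (cong v (cpred^-period i))

sumℤ-cong : ∀ {k} {f g : Fin k → ℤ} → f ≗ g → sumℤ f ≡ sumℤ g
sumℤ-cong {zero}  f≗g = refl
sumℤ-cong {suc k} f≗g = cong₂ _+_ (f≗g zero) (sumℤ-cong (λ i → f≗g (suc i)))

sumℤ-linear : ∀ {k} α β (f g : Fin k → ℤ) →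
  sumℤ (λ i → α * f i + β * g i) ≡ α * sumℤ f + β * sumℤ g
sumℤ-linear {zero}  α β f g = solve (α ∷ β ∷ [])
sumℤ-linear {suc k} α β f g = begin
  α * f zero + β * g zero + sumℤ (λ i → α * f (suc i) + β * g (suc i))
    ≡⟨ cong (_+_ (α * f zero + β * g zero)) (sumℤ-linear α β (λ i → f (suc i)) (λ i → g (suc i))) ⟩
  α * f zero + β * g zero + (α * sumℤ (λ i → f (suc i)) + β * sumℤ (λ i → g (suc i)))
    ≡⟨ regroup α β (f zero) (g zero) _ _ ⟩
  α * (f zero + sumℤ (λ i → f (suc i))) + β * (g zero + sumℤ (λ i → g (suc i))) ∎
  where
  open ≡-Reasoning
  regroup : ∀ α β a b s t → α * a + β * b + (α * s + β * t) ≡ α * (a + s) + β * (b + t)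
  regroup = solve-∀

sumℤ-last : ∀ {m} (f : Fin (suc m) → ℤ) → sumℤ f ≡ sumℤ (λ i → f (inject₁ i)) + f (fromℕ m)
sumℤ-last {zero}  f = ℤP.+-comm (f zero) (+ 0)
sumℤ-last {suc m} f = trans (cong (_+_ (f zero)) (sumℤ-last (λ i → f (suc i))))
                            (sym (ℤP.+-assoc (f zero) _ _))

sumℤ-cpred : ∀ {k} (f : Fin k → ℤ) → sumℤ (λ i → f (cpred i)) ≡ sumℤ f
sumℤ-cpred {zero}  f = refl
sumℤ-cpred {suc m} f = trans (ℤP.+-comm (f (fromℕ m)) _) (sym (sumℤ-last f))

circulant : ∀ {k} → (Fin k → ℕ) → (Fin k → ℤ) → Vecℤ k
circulant a x i = sumℤ (λ j → x j * column a j i)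

circulant-linear : ∀ {k} (a : Fin k → ℕ) α β x y i →
  circulant a (λ j → α * x j + β * y j) i ≡ α * circulant a x i + β * circulant a y i
circulant-linear a α β x y i =
  trans (sumℤ-cong (λ j → distrib α β (x j) (y j) (column a j i)))
        (sumℤ-linear α β (λ j → x j * column a j i) (λ j → y j * column a j i))
  where
  distrib : ∀ α β x y c → (α * x + β * y) * c ≡ α * (x * c) + β * (y * c)
  distrib = solve-∀

σ-column : ∀ {k} (a : Fin k → ℕ) j i → σ (column a (cpred j)) i ≡ column a j i
σ-column {suc m} a zero i =
  trans (cong (λ t → σ^ (suc t) (toℤ a) i) (toℕ-fromℕ m)) (σ^-period (toℤ a) i)
σ-column a (suc j) i = cong (λ t → σ^ (suc t) (toℤ a) i) (toℕ-inject₁ j)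

circulant-cpred : ∀ {k} (a : Fin k → ℕ) x i →
  circulant a x (cpred i) ≡ circulant a (λ j → x (cpred j)) i
circulant-cpred a x i = begin
  sumℤ (λ j → x j * column a j (cpred i))
    ≡⟨ sumℤ-cong (λ j → cong (x j *_) (σ-apply (column a j) i)) ⟨
  sumℤ (λ j → x j * σ (column a j) i)
    ≡⟨ sumℤ-cpred (λ j → x j * σ (column a j) i) ⟨
  sumℤ (λ j → x (cpred j) * σ (column a (cpred j)) i)
    ≡⟨ sumℤ-cong (λ j → cong (x (cpred j) *_) (σ-column a j i)) ⟩
  sumℤ (λ j → x (cpred j) * column a j i) ∎
  where open ≡-Reasoning

infixr 7 _·_
_·_ : ∀ {k} → ℤ → Vecℤ k → Vecℤ k
(c · v) i = c * v i

record IsInvariantSubmodule {k} (P : Vecℤ k → Set) : Set where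
  field
    ⊕-closed : ∀ {v w} → P v → P w → P (v ⊕ w)
    ⊖-closed : ∀ {v w} → P v → P w → P (v ⊖ w)
    *-closed : ∀ {v} c → P v → P (c · v)
    σ-closed : ∀ {v} → P v → P (σ v)

  σ^-closed : ∀ {v} j → P v → P (σ^ j v)
  σ^-closed zero    p = p
  σ^-closed (suc j) p = σ-closed (σ^-closed j p)

module _ {k} (M : ℕ) (a : Fin k → ℕ) where

  InMonodromy-≗ : ∀ {v w} → v ≗ w → InMonodromy M a v → InMonodromy M a w
  InMonodromy-≗ v≗w (x , v≡Cx) = x , λ i → subst (_≡ circulant a x i [mod M ]) (v≗w i) (v≡Cx i)

  InMonodromy-linear : ∀ α β {v w} → InMonodromy M a v → InMonodromy M a w →
    InMonodromy M a (λ i → α * v i + β * w i)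
  InMonodromy-linear α β {v} {w} (x , v≡Cx) (y , w≡Cy) = (λ j → α * x j + β * y j) , λ i → begin
    α * v i + β * w i
      ≈⟨ mod-+-cong (α * v i) (α * circulant a x i) (β * w i) (β * circulant a y i)
           (mod-*-congˡ α (v i) (circulant a x i) (v≡Cx i))
           (mod-*-congˡ β (w i) (circulant a y i) (w≡Cy i)) ⟩
    α * circulant a x i + β * circulant a y i
      ≡⟨ circulant-linear a α β x y i ⟨
    circulant a (λ j → α * x j + β * y j) i ∎
    where open SetoidReasoning (modSetoid M)

  InMonodromy-isInvariantSubmodule : IsInvariantSubmodule (InMonodromy M a)
  InMonodromy-isInvariantSubmodule = record
    { ⊕-closed = λ {v} {w} p q →
        InMonodromy-≗ (λ i → add (v i) (w i)) (InMonodromy-linear (+ 1) (+ 1) {v} {w} p q)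
    ; ⊖-closed = λ {v} {w} p q →
        InMonodromy-≗ (λ i → sub (v i) (w i)) (InMonodromy-linear (+ 1) (- + 1) {v} {w} p q)
    ; *-closed = λ {v} c p →
        InMonodromy-≗ (λ i → scale c (v i)) (InMonodromy-linear c (+ 0) {v} {v} p p)
    ; σ-closed = σ-closed
    }
    where
    add : ∀ x y → + 1 * x + + 1 * y ≡ x + y
    add = solve-∀
    sub : ∀ x y → + 1 * x + - + 1 * y ≡ x - y
    sub = solve-∀
    scale : ∀ c x → c * x + + 0 * x ≡ c * x
    scale = solve-∀
    σ-closed : ∀ {v} → InMonodromy M a v → InMonodromy M a (σ v)
    σ-closed {v} (x , v≡Cx) = (λ j → x (cpred j)) , λ i → begin
      σ v i                                  ≡⟨ σ-apply v i ⟩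
      v (cpred i)                            ≈⟨ v≡Cx (cpred i) ⟩
      circulant a x (cpred i)                ≡⟨ circulant-cpred a x i ⟩
      circulant a (λ j → x (cpred j)) i      ∎
      where open SetoidReasoning (modSetoid M)

gcdAll-∣ : ∀ {k} (a : Fin k → ℕ) {m n} → m ℕ.∣ n → gcdAll a m ℕ.∣ gcdAll a n
gcdAll-∣ {zero}  a m∣n = m∣n
gcdAll-∣ {suc k} a m∣n =
  gcd-greatest (gcd[m,n]∣m (a zero) _)
               (ℕ.∣-trans (gcd[m,n]∣n (a zero) _) (gcdAll-∣ (λ i → a (suc i)) m∣n))

IsAlgebraicGon-∣ : ∀ {k m n a} → m ℕ.∣ n → IsAlgebraicGon k n a → IsAlgebraicGon k m a
IsAlgebraicGon-∣ {a = a} m∣n gon = record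
  { sum≡0   = ℕ.∣-trans m∣n sum≡0
  ; coprime = ℕ.∣1⇒≡1 (subst (_ ℕ.∣_) coprime (gcdAll-∣ a m∣n))
  }
  where open IsAlgebraicGon gon

module _ (m n : ℕ) .{{_ : NonZero n}} {k} (a : Fin k → ℕ) where

  private
    S T : SQ k
    S = monodromySQ m a
    T = scaledSQ (m ℕ.* n) n (InMonodromy (m ℕ.* n) a)

  monodromy≅scaled : AbIso (monodromySQ m a) (scaledSQ (m ℕ.* n) n (InMonodromy (m ℕ.* n) a))
  monodromy≅scaled = record { f = f ; resp = resp ; hom = hom ; inj = inj ; surj = surj }
    where
    f : Elt S → Elt T
    f (v , x , v≡Cx) = + n · v , circulant a x , (x , λ i → mod-refl (circulant a x i))
                     , λ i → mod-*-scale n (v i) (circulant a x i) (v≡Cx i)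

    resp : ∀ u u′ → Null S (proj₁ u ⊖ proj₁ u′) → Null T (proj₁ (f u) ⊖ proj₁ (f u′))
    resp (v , _) (v′ , _) v≡v′ i = ≡⇒-≡0 (+ n * v i) (+ n * v′ i)
      (mod-*-scale n (v i) (v′ i) (-≡0⇒≡ (v i) (v′ i) (v≡v′ i)))

    hom : ∀ u u′ u″ → (∀ i → proj₁ u″ i ≡ proj₁ u i + proj₁ u′ i) →
          Null T (proj₁ (f u″) ⊖ (proj₁ (f u) ⊕ proj₁ (f u′)))
    hom (v , _) (v′ , _) (v″ , _) v″≗v+v′ i = mod-reflexive (begin
      + n * v″ i - (+ n * v i + + n * v′ i)          ≡⟨ cong (λ z → + n * z - (+ n * v i + + n * v′ i)) (v″≗v+v′ i) ⟩
      + n * (v i + v′ i) - (+ n * v i + + n * v′ i)  ≡⟨ distrib (+ n) (v i) (v′ i) ⟩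
      + 0                                           ∎)
      where
      open ≡-Reasoning
      distrib : ∀ c x y → c * (x + y) - (c * x + c * y) ≡ + 0
      distrib = solve-∀

    inj : ∀ u u′ → Null T (proj₁ (f u) ⊖ proj₁ (f u′)) → Null S (proj₁ u ⊖ proj₁ u′)
    inj (v , _) (v′ , _) nv≡nv′ i = ≡⇒-≡0 (v i) (v′ i)
      (mod-*-cancel n (v i) (v′ i) (-≡0⇒≡ (+ n * v i) (+ n * v′ i) (nv≡nv′ i)))

    surj : (u : Elt T) → Σ (Elt S) λ u′ → Null T (proj₁ (f u′) ⊖ proj₁ u)
    surj (y , w , (x , w≡Cx) , y≡nw) = (circulant a x , x , λ i → mod-refl (circulant a x i))
      , λ i → ≡⇒-≡0 (+ n * circulant a x i) (y i) (begin
          + n * circulant a x i  ≈⟨ mod-*-congˡ (+ n) (w i) (circulant a x i) (w≡Cx i) ⟨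
          + n * w i              ≈⟨ y≡nw i ⟨
          y i                    ∎)
      where open SetoidReasoning (modSetoid (m ℕ.* n))

private
  pos-bézout : ∀ a b c d → 1 ℕ.+ a ℕ.* b ≡ c ℕ.* d → + c * + d + - + a * + b ≡ + 1
  pos-bézout a b c d eq = begin
    + c * + d + - + a * + b          ≡⟨ cong (λ z → z + - + a * + b) (ℤP.pos-* c d) ⟨
    + (c ℕ.* d) + - + a * + b        ≡⟨ cong (λ z → + z + - + a * + b) eq ⟨
    + 1 + + (a ℕ.* b) + - + a * + b  ≡⟨ cong (λ z → + 1 + z + - + a * + b) (ℤP.pos-* a b) ⟩
    + 1 + + a * + b + - + a * + b    ≡⟨ cancel (+ a) (+ b) ⟩
    + 1                              ∎
    where
    open ≡-Reasoning
    cancel : ∀ a b → + 1 + a * b + - a * b ≡ + 1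
    cancel = solve-∀

bézout : ∀ m n → gcd m n ≡ 1 → ∃₂ λ s t → s * + m + t * + n ≡ + 1
bézout m n gcd≡1 with subst (λ d → Bézout.Identity d m n) gcd≡1 (Bézout.identity (gcd-GCD m n))
... | Bézout.+- x y eq = + x , - + y , pos-bézout y n x m eq
... | Bézout.-+ x y eq = - + x , + y , trans (ℤP.+-comm (- + x * + m) _) (pos-bézout x m y n eq)

module _ (m n : ℕ) (s t : ℤ) (bz : s * + m + t * + n ≡ + 1) where

  bézout-residue : ∀ d → d - + m * (s * d) ≡ t * (+ n * d)
  bézout-residue d = begin
    d - + m * (s * d)                      ≡⟨ cong (_- + m * (s * d)) (ℤP.*-identityʳ d) ⟨
    d * + 1 - + m * (s * d)                ≡⟨ cong (λ z → d * z - + m * (s * d)) bz ⟨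
    d * (s * + m + t * + n) - + m * (s * d) ≡⟨ regroup d s t (+ m) (+ n) ⟩
    t * (+ n * d)                          ∎
    where
    open ≡-Reasoning
    regroup : ∀ d s t m n → d * (s * m + t * n) - m * (s * d) ≡ t * (n * d)
    regroup = solve-∀

  n-torsion⇒m-multiple : ∀ x y → (+ n * x) ≡ (+ n * y) [mod m ℕ.* n ] →
                         (x - y) ≡ (+ m * (s * (x - y))) [mod m ℕ.* n ]
  n-torsion⇒m-multiple x y nx≡ny = -≡0⇒≡ (x - y) (+ m * (s * (x - y))) (begin
    x - y - + m * (s * (x - y))   ≡⟨ bézout-residue (x - y) ⟩
    t * (+ n * (x - y))           ≡⟨ cong (t *_) (*-distribˡ-- (+ n) x y) ⟩
    t * (+ n * x - + n * y)       ≈⟨ mod-*-congˡ t (+ n * x - + n * y) (+ 0)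
                                       (≡⇒-≡0 (+ n * x) (+ n * y) nx≡ny) ⟩
    t * + 0                       ≡⟨ ℤP.*-zeroʳ t ⟩
    + 0                           ∎)
    where open SetoidReasoning (modSetoid (m ℕ.* n))

m-multiple⇒n-torsion : ∀ m n x y u → (x - y) ≡ (+ m * u) [mod m ℕ.* n ] →
                       (+ n * x) ≡ (+ n * y) [mod m ℕ.* n ]
m-multiple⇒n-torsion m n x y u x-y≡mu = mod-*-scale n x y (-≡0⇒≡ x y (begin
  x - y     ≈⟨ ℕ.∣-trans (ℕ.m∣m*n n) x-y≡mu ⟩
  + m * u   ≡⟨ ℤP.*-comm (+ m) u ⟩
  u * + m   ≈⟨ mod-multiple u ⟩
  + 0       ∎))
  where open SetoidReasoning (modSetoid m)

module _ (m n : ℕ) (s t : ℤ) (bz : s * + m + t * + n ≡ + 1)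
         {k} {P : Vecℤ k → Set} (P-invariant : IsInvariantSubmodule P) where

  open IsInvariantSubmodule P-invariant

  private
    M : ℕ
    M = m ℕ.* n
    S T : SQ k
    S = scaledSQ M n P
    T = quotientSQ M m P

  scaled-≋⇒null : ∀ {w w′} → P w → P w′ → (+ n · w) ≋ (+ n · w′) [mod m ℕ.* n ] →
                  Null (quotientSQ (m ℕ.* n) m P) (w ⊖ w′)
  scaled-≋⇒null {w} {w′} pw pw′ nw≡nw′ = s · (w ⊖ w′) , *-closed s (⊖-closed pw pw′)
    , λ i → n-torsion⇒m-multiple m n s t bz (w i) (w′ i) (nw≡nw′ i)

  scaled⋊≅quotient⋊ : SDIso (scaledSQ (m ℕ.* n) n P) (quotientSQ (m ℕ.* n) m P)
  scaled⋊≅quotient⋊ = record { F = F ; resp = resp ; hom = hom ; inj = inj ; surj = surj }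
    where
    open SetoidReasoning (modSetoid M)

    F : SDElt S → SDElt T
    F ((_ , w , pw , _) , j) = (w , pw) , j

    resp : ∀ x y → SDEq S (raw {S = S} x) (raw {S = S} y) → SDEq T (raw {S = T} (F x)) (raw {S = T} (F y))
    resp ((v , w , pw , v≡nw) , _) ((v′ , w′ , pw′ , v′≡nw′) , _) (v≡v′ , j≡j′) =
      scaled-≋⇒null pw pw′ (λ i → begin
        + n * w i    ≈⟨ v≡nw i ⟨
        v i          ≈⟨ -≡0⇒≡ (v i) (v′ i) (v≡v′ i) ⟩
        v′ i         ≈⟨ v′≡nw′ i ⟩
        + n * w′ i   ∎)
      , j≡j′

    hom : ∀ x y z → SDEq S (raw {S = S} z) (sdMul (raw {S = S} x) (raw {S = S} y)) →
          SDEq T (raw {S = T} (F z)) (sdMul (raw {S = T} (F x)) (raw {S = T} (F y)))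
    hom ((v₁ , w₁ , pw₁ , v₁≡nw₁) , j) ((v₂ , w₂ , pw₂ , v₂≡nw₂) , _) ((v , w , pw , v≡nw) , _) (v≡v₁v₂ , j≡j₁+j₂) =
      scaled-≋⇒null pw (⊕-closed pw₁ (σ^-closed j pw₂)) (λ i → begin
        + n * w i                                ≈⟨ v≡nw i ⟨
        v i                                      ≈⟨ -≡0⇒≡ (v i) (v₁ i + σ^ j v₂ i) (v≡v₁v₂ i) ⟩
        v₁ i + σ^ j v₂ i                         ≈⟨ mod-+-cong (v₁ i) (+ n * w₁ i) (σ^ j v₂ i) (+ n * σ^ j w₂ i)
                                                      (v₁≡nw₁ i) (σ^v₂≡nσ^w₂ i) ⟩
        + n * w₁ i + + n * σ^ j w₂ i             ≡⟨ ℤP.*-distribˡ-+ (+ n) (w₁ i) (σ^ j w₂ i) ⟨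
        + n * (w₁ i + σ^ j w₂ i)                 ∎)
      , j≡j₁+j₂
      where
      σ^v₂≡nσ^w₂ : ∀ i → σ^ j v₂ i ≡ (+ n * σ^ j w₂ i) [mod M ]
      σ^v₂≡nσ^w₂ i = begin
        σ^ j v₂ i                ≡⟨ σ^-apply j v₂ i ⟩
        v₂ (cpred^ j i)          ≈⟨ v₂≡nw₂ (cpred^ j i) ⟩
        + n * w₂ (cpred^ j i)    ≡⟨ cong (+ n *_) (σ^-apply j w₂ i) ⟨
        + n * σ^ j w₂ i          ∎

    inj : ∀ x y → SDEq T (raw {S = T} (F x)) (raw {S = T} (F y)) → SDEq S (raw {S = S} x) (raw {S = S} y)
    inj ((v , w , _ , v≡nw) , _) ((v′ , w′ , _ , v′≡nw′) , _) ((u , _ , w-w′≡mu) , j≡j′) =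
      (λ i → ≡⇒-≡0 (v i) (v′ i) (begin
        v i          ≈⟨ v≡nw i ⟩
        + n * w i    ≈⟨ m-multiple⇒n-torsion m n (w i) (w′ i) (u i) (w-w′≡mu i) ⟩
        + n * w′ i   ≈⟨ v′≡nw′ i ⟨
        v′ i         ∎))
      , j≡j′

    surj : (y : SDElt T) → Σ (SDElt S) λ x → SDEq T (raw {S = T} (F x)) (raw {S = T} y)
    surj ((w , pw) , j) = ((+ n · w , w , pw , λ i → mod-refl (+ n * w i)) , j)
                        , scaled-≋⇒null pw pw (λ i → mod-refl (+ n * w i)) , mod-refl (+ j)

proposition4 : (k n₁ n₂ : ℕ) → 2 ℕ.≤ k → 1 ℕ.< n₁ → 1 ℕ.< n₂ →
    (c : Fin k → ℕ) → IsAlgebraicGon k (n₁ ℕ.* n₂) c →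
    (Σ (Fin k → ℕ) λ a → IsAlgebraicGon k n₁ a ×
        AbIso (monodromySQ n₁ a) (scaledSQ (n₁ ℕ.* n₂) n₂ (InMonodromy (n₁ ℕ.* n₂) c)))
    × (gcd n₁ n₂ ≡ 1 →
        SDIso (scaledSQ (n₁ ℕ.* n₂) n₂ (InMonodromy (n₁ ℕ.* n₂) c))
              (quotientSQ (n₁ ℕ.* n₂) n₁ (InMonodromy (n₁ ℕ.* n₂) c)))
proposition4 k n₁ n₂ _ _ 1<n₂ c c-gon =
    (c , IsAlgebraicGon-∣ (ℕ.m∣m*n n₂) c-gon , monodromy≅scaled n₁ n₂ c)
  , λ gcd≡1 → let s , t , bz = bézout n₁ n₂ gcd≡1 in
      scaled⋊≅quotient⋊ n₁ n₂ s t bz (InMonodromy-isInvariantSubmodule (n₁ ℕ.* n₂) c)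
  where
  instance
    n₂-nonZero : NonZero n₂
    n₂-nonZero = ℕ.>-nonZero (ℕP.<⇒≤ 1<n₂)
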